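{- Let $G$ be an imperfect pseudo-split graph with pseudo-split partition $(C,S,I)$ and let $k,\ell$ be nonnegative integers. Then: (1) $G$ is $(k,0)$-colorable if and only if $|C|\le k-3$; (2) $G$ is $(0,\ell)$-colorable if and only if $|I|\le \ell-3$; (3) $G$ is not $(1,1)$-colorable; (4) if $k,\ell$ are positive and $k+\ell\ge 3$, then $G$ is $(k,\ell)$-colorable. In particular $\chi(G)=|C|+3$ and $\theta(G)=|I|+3$.
   Context: All graphs are finite and simple. A pseudo-split partition of $G$ is a partition $(C,S,I)$ of $V_G$ with $C$ a clique, $I$ independent, $S=\varnothing$ or $G[S]\cong C_5$, $C$ completely adjacent to $S$, and no edges between $I$ and $S$; $G$ is imperfect pseudo-split if it has one with $S\neq\varnothing$. A $(k,\ell)$-coloring of $G$ is a partition of $V_G$ into $k$ independent sets and $\ell$ cliques (parts may be empty); $G$ is $(k,\ell)$-colorable if it has one. $\chi(G)$ is the chromatic number and $\theta(G)$ the minimum number of cliques covering $V_G$ (clique covering number). -}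

module Defs where

open import Level using (0ℓ)
open import Data.Nat using (ℕ; _≤_; _+_)
open import Data.Nat.DivMod using (_%_)
open import Data.Fin using (Fin; toℕ)
open import Data.List using (length; filter)
open import Data.List.Base using ()
open import Data.Fin.Base using ()
open import Data.List using (List)
open import Data.Product using (Σ; _×_; ∃)
open import Data.Sum using (_⊎_; inj₁; inj₂)
open import Data.Empty using (⊥)
open import Relation.Nullary using (¬_; Dec; yes; no)
open import Relation.Binary.PropositionalEquality using (_≡_; _≢_)
open import Function.Definitions using (Injective)
import Data.List as L
open import Data.Fin using () renaming (_≟_ to _≟F_)

record Graph : Set₁ where
  field
    n       : ℕ
    Adj     : Fin n → Fin n → Set
    symAdj  : ∀ {u v} → Adj u v → Adj v u
    irrAdj  : ∀ {u} → ¬ Adj u u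
open Graph public

Vtx : Graph → Set
Vtx G = Fin (n G)

data Part : Set where
  cP sP iP : Part

_≟P_ : (x y : Part) → Dec (x ≡ y)
cP ≟P cP = yes _≡_.refl
cP ≟P sP = no (λ ())
cP ≟P iP = no (λ ())
sP ≟P cP = no (λ ())
sP ≟P sP = yes _≡_.refl
sP ≟P iP = no (λ ())
iP ≟P cP = no (λ ())
iP ≟P sP = no (λ ())
iP ≟P iP = yes _≡_.refl

allV : (G : Graph) → List (Vtx G)
allV G = L.allFin (n G)

partSize : (G : Graph) → (Vtx G → Part) → Part → ℕ
partSize G tag p = length (filter (λ v → tag v ≟P p) (allV G))

IsClique : (G : Graph) → (Vtx G → Set) → Set
IsClique G X = ∀ u v → X u → X v → u ≢ v → Adj G u v

IsIndependent : (G : Graph) → (Vtx G → Set) → Set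
IsIndependent G X = ∀ u v → X u → X v → ¬ Adj G u v

C5Adj : Fin 5 → Fin 5 → Set
C5Adj i j = (toℕ j ≡ (toℕ i + 1) % 5) ⊎ (toℕ i ≡ (toℕ j + 1) % 5)

InducesC5 : (G : Graph) → (Vtx G → Set) → Set
InducesC5 G X =
  Σ (Fin 5 → Vtx G) λ f →
    Injective _≡_ _≡_ f ×
    (∀ i → X (f i)) ×
    (∀ v → X v → ∃ λ i → f i ≡ v) ×
    (∀ i j → (Adj G (f i) (f j) → C5Adj i j) × (C5Adj i j → Adj G (f i) (f j)))

IsPseudoSplitPartition : (G : Graph) → (Vtx G → Part) → Set
IsPseudoSplitPartition G tag =
  IsClique G (λ v → tag v ≡ cP) ×
  IsIndependent G (λ v → tag v ≡ iP) ×
  ((∀ v → tag v ≢ sP) ⊎ InducesC5 G (λ v → tag v ≡ sP)) ×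
  (∀ u v → tag u ≡ cP → tag v ≡ sP → Adj G u v) ×
  (∀ u v → tag u ≡ iP → tag v ≡ sP → ¬ Adj G u v)

-- G is imperfect pseudo-split: has a pseudo-split partition with S ≠ ∅
IsImperfectPseudoSplit : Graph → Set
IsImperfectPseudoSplit G =
  Σ (Vtx G → Part) λ tag → IsPseudoSplitPartition G tag × InducesC5 G (λ v → tag v ≡ sP)

-- (k,ℓ)-coloring: each vertex goes to one of k independent sets (inj₁)
-- or one of ℓ cliques (inj₂); parts may be empty.
IsKLColoring : (G : Graph) (k ℓ : ℕ) → (Vtx G → Fin k ⊎ Fin ℓ) → Set
IsKLColoring G k ℓ col =
  (∀ a → IsIndependent G (λ v → col v ≡ inj₁ a)) ×
  (∀ b → IsClique G (λ v → col v ≡ inj₂ b))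

KLColorable : Graph → ℕ → ℕ → Set
KLColorable G k ℓ = Σ (Vtx G → Fin k ⊎ Fin ℓ) (IsKLColoring G k ℓ)

IsChromaticNumber : Graph → ℕ → Set
IsChromaticNumber G m = KLColorable G m 0 × (∀ k → KLColorable G k 0 → m ≤ k)

IsCliqueCoverNumber : Graph → ℕ → Set
IsCliqueCoverNumber G m = KLColorable G 0 m × (∀ ℓ → KLColorable G 0 ℓ → m ≤ ℓ)

{-# OPTIONS --safe #-}
module Submission where

-- S induces a C₅, which needs three colors, needs three cliques and is not split.
-- C is a clique complete to S, so a proper coloring spends |C| colors on C and
-- three further colors on S; dually, in the complement graph (again pseudo-split,
-- C₅ being self-complementary) the independent set I becomes such a clique, which
-- bounds the number of cliques by |I| + 3. Conversely, colorings are assembled part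
-- by part from colorings of C₅: C (resp. I) gets fresh singleton classes, or C joins
-- a clique class and I an independent class of a (1,2)- or (2,1)-coloring of C₅.
-- An induced C₅ is not (1,1)-colorable, which also excludes S = ∅.

open import Defs
open import Data.Nat as ℕ using (ℕ; suc; _+_; _≤_; s≤s)
open import Data.Nat.Properties using (≤-refl)
open import Data.Fin using (Fin; zero; suc; #_; toℕ; _↑ˡ_; _↑ʳ_; inject≤; splitAt; join)
open import Data.Fin.Properties
  using (all?; injective⇒≤; ↑ˡ-injective; ↑ʳ-injective; inject≤-injective; splitAt-↑ˡ; splitAt-↑ʳ; join-splitAt)
  renaming (_≟_ to _≟ᶠ_)
open import Data.List using (List; _∷_; lookup; filter)
open import Data.List.Membership.Propositional using (_∈_)
open import Data.List.Membership.Propositional.Properties using (∈-lookup; ∈-filter⁺; ∈-filter⁻; ∈-allFin)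
import Data.List.Relation.Unary.All as All
open import Data.List.Relation.Unary.Any using (index)
open import Data.List.Relation.Unary.Any.Properties using (lookup-index)
open import Data.List.Relation.Unary.AllPairs using (_∷_)
import Data.List.Relation.Unary.Unique.Propositional as ListUnique
import Data.List.Relation.Unary.Unique.Propositional.Properties as ListUnique
open import Data.Vec as Vec using (Vec; _∷_; [])
open import Data.Vec.Properties using (lookup-map)
open import Data.Vec.Relation.Unary.All using ([]; _∷_)
open import Data.Vec.Relation.Unary.AllPairs using ([]; _∷_)
import Data.Vec.Relation.Unary.Unique.Propositional as VecUnique
import Data.Vec.Relation.Unary.Unique.Propositional.Properties as VecUnique
open import Data.Sum as Sum using (_⊎_; inj₁; inj₂; [_,_]′; fromInj₁; fromInj₂)
open import Data.Sum.Properties using (inj₁-injective; inj₂-injective; ≡-dec)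
open import Data.Product using (Σ; ∃; _×_; _,_; proj₁; proj₂)
open import Data.Empty using (⊥; ⊥-elim)
open import Function using (_∘_; id; const)
open import Function.Bundles using (_⇔_; mk⇔)
open import Function.Definitions using (Injective)
open import Relation.Nullary using (¬_; Dec; yes; no)
open import Relation.Nullary.Decidable using (_⊎-dec_; _×-dec_; _→-dec_; ¬?; from-yes)
open import Relation.Binary.PropositionalEquality using (_≡_; _≢_; refl; sym; trans; cong; subst)

↑ˡ≢↑ʳ : ∀ {m n} (i : Fin m) (j : Fin n) → i ↑ˡ n ≢ m ↑ʳ j
↑ˡ≢↑ʳ {m} {n} i j e with trans (sym (splitAt-↑ˡ m i n)) (trans (cong (splitAt m) e) (splitAt-↑ʳ m n j))
... | ()

splitAt-injective : ∀ m {n} → Injective _≡_ _≡_ (splitAt m {n})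
splitAt-injective m {n} {i} {j} e =
  trans (sym (join-splitAt m n i)) (trans (cong (join m n) e) (join-splitAt m n j))

⊎-injection⇒+≤ : ∀ {m n k} (h : Fin m ⊎ Fin n → Fin k) → Injective _≡_ _≡_ h → m + n ≤ k
⊎-injection⇒+≤ {m} h h-injective = injective⇒≤ (splitAt-injective m ∘ h-injective)

[,]-injective : ∀ {A B C : Set} {f : A → C} {g : B → C} →
  Injective _≡_ _≡_ f → Injective _≡_ _≡_ g → (∀ a b → f a ≢ g b) → Injective _≡_ _≡_ [ f , g ]′
[,]-injective f-inj g-inj f≢g {inj₁ a} {inj₁ a′} e = cong inj₁ (f-inj e)
[,]-injective f-inj g-inj f≢g {inj₁ a} {inj₂ b}  e = ⊥-elim (f≢g a b e)
[,]-injective f-inj g-inj f≢g {inj₂ b} {inj₁ a}  e = ⊥-elim (f≢g a b (sym e))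
[,]-injective f-inj g-inj f≢g {inj₂ b} {inj₂ b′} e = cong inj₂ (g-inj e)

unique-lookup-injective : ∀ {A : Set} {xs : List A} → ListUnique.Unique xs → Injective _≡_ _≡_ (lookup xs)
unique-lookup-injective {xs = _ ∷ _}  _          {zero}  {zero}  _ = refl
unique-lookup-injective {xs = _ ∷ xs} (x∉xs ∷ _) {zero}  {suc j} e = ⊥-elim (All.lookup x∉xs (∈-lookup {xs = xs} j) e)
unique-lookup-injective {xs = _ ∷ xs} (x∉xs ∷ _) {suc i} {zero}  e = ⊥-elim (All.lookup x∉xs (∈-lookup {xs = xs} i) (sym e))
unique-lookup-injective {xs = _ ∷ _}  (_ ∷ xs-unique) {suc i} {suc j} e = cong suc (unique-lookup-injective xs-unique e)

IsHomomorphism : (H G : Graph) → (Vtx H → Vtx G) → Set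
IsHomomorphism H G f = ∀ i j → Adj H i j → Adj G (f i) (f j)

IsInducedEmbedding : (H G : Graph) → (Vtx H → Vtx G) → Set
IsInducedEmbedding H G f =
  Injective _≡_ _≡_ f × (∀ i j → (Adj G (f i) (f j) → Adj H i j) × (Adj H i j → Adj G (f i) (f j)))

complement : Graph → Graph
complement G = record
  { n      = n G
  ; Adj    = λ u v → u ≢ v × ¬ Adj G u v
  ; symAdj = λ (u≢v , ¬uv) → u≢v ∘ sym , ¬uv ∘ symAdj G
  ; irrAdj = λ (u≢u , _) → u≢u refl
  }

complement-homomorphism : ∀ {H G f} → IsInducedEmbedding H G f →
  IsHomomorphism (complement H) (complement G) f
complement-homomorphism (f-injective , f-adj) i j (i≢j , ¬ij) =
  i≢j ∘ f-injective , ¬ij ∘ proj₁ (f-adj i j)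

IsProperColoring : (G : Graph) {k : ℕ} → (Vtx G → Fin k) → Set
IsProperColoring G c = ∀ u v → Adj G u v → c u ≢ c v

ProperColorable : Graph → ℕ → Set
ProperColorable G k = Σ (Vtx G → Fin k) (IsProperColoring G)

KLColorable⇒ProperColorable : ∀ G {k} → KLColorable G k 0 → ProperColorable G k
KLColorable⇒ProperColorable G (col , independent , _) =
  c , λ u v uv cu≡cv → independent (c u) u v (as-inj₁ (col u)) (trans (as-inj₁ (col v)) (cong inj₁ (sym cu≡cv))) uv
  where
  c : Vtx G → Fin _
  c = fromInj₁ (λ ()) ∘ col
  as-inj₁ : ∀ {k} (x : Fin k ⊎ Fin 0) → x ≡ inj₁ (fromInj₁ (λ ()) x)
  as-inj₁ (inj₁ _) = refl

KLColorable⇒ProperColorable-complement : ∀ G {ℓ} → KLColorable G 0 ℓ → ProperColorable (complement G) ℓ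
KLColorable⇒ProperColorable-complement G (col , _ , clique) =
  c , λ u v (u≢v , ¬uv) cu≡cv →
    ¬uv (clique (c u) u v (as-inj₂ (col u)) (trans (as-inj₂ (col v)) (cong inj₂ (sym cu≡cv))) u≢v)
  where
  c : Vtx G → Fin _
  c = fromInj₂ (λ ()) ∘ col
  as-inj₂ : ∀ {ℓ} (x : Fin 0 ⊎ Fin ℓ) → x ≡ inj₂ (fromInj₂ (λ ()) x)
  as-inj₂ (inj₂ _) = refl

isKLColoring? : (G : Graph) → (∀ u v → Dec (Adj G u v)) →
  ∀ {k ℓ} (col : Vtx G → Fin k ⊎ Fin ℓ) → Dec (IsKLColoring G k ℓ col)
isKLColoring? G adj? col =
  all? (λ a → all? λ u → all? λ v → col u ≟ inj₁ a →-dec col v ≟ inj₁ a →-dec ¬? (adj? u v)) ×-dec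
  all? (λ b → all? λ u → all? λ v → col u ≟ inj₂ b →-dec col v ≟ inj₂ b →-dec ¬? (u ≟ᶠ v) →-dec adj? u v)
  where
  _≟_ : ∀ {k ℓ} (x y : Fin k ⊎ Fin ℓ) → Dec (x ≡ y)
  _≟_ = ≡-dec _≟ᶠ_ _≟ᶠ_

isKLColoring-map : ∀ G {k ℓ k′ ℓ′ col} {g : Fin k → Fin k′} {h : Fin ℓ → Fin ℓ′} →
  Injective _≡_ _≡_ g → Injective _≡_ _≡_ h →
  IsKLColoring G k ℓ col → IsKLColoring G k′ ℓ′ (Sum.map g h ∘ col)
isKLColoring-map G {col = col} {g} {h} g-injective h-injective (independent , clique) =
  independent′ , clique′
  where
  independent′ : ∀ a → IsIndependent G (λ v → Sum.map g h (col v) ≡ inj₁ a)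
  independent′ a u v eu ev with col u in cu | col v in cv
  independent′ _ u v refl ev | inj₁ x | inj₁ y =
    independent x u v cu (trans cv (cong inj₁ (g-injective (inj₁-injective ev))))
  clique′ : ∀ b → IsClique G (λ v → Sum.map g h (col v) ≡ inj₂ b)
  clique′ b u v eu ev with col u in cu | col v in cv
  clique′ _ u v refl ev | inj₂ x | inj₂ y =
    clique x u v cu (trans cv (cong inj₂ (h-injective (inj₂-injective ev))))

KLColorable-mono : ∀ G {k ℓ k′ ℓ′} → k ≤ k′ → ℓ ≤ ℓ′ → KLColorable G k ℓ → KLColorable G k′ ℓ′
KLColorable-mono G k≤k′ ℓ≤ℓ′ (col , coloring) =
  Sum.map (λ a → inject≤ a k≤k′) (λ b → inject≤ b ℓ≤ℓ′) ∘ col ,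
  isKLColoring-map G (inject≤-injective k≤k′ k≤k′ _ _) (inject≤-injective ℓ≤ℓ′ ℓ≤ℓ′ _ _) coloring

isKLColoring-restrict : ∀ H G {k ℓ f col} → IsInducedEmbedding H G f →
  IsKLColoring G k ℓ col → IsKLColoring H k ℓ (col ∘ f)
isKLColoring-restrict H G {f = f} (f-injective , f-adj) (independent , clique) =
  (λ a i j ei ej → independent a (f i) (f j) ei ej ∘ proj₂ (f-adj i j)) ,
  (λ b i j ei ej i≢j → proj₁ (f-adj i j) (clique b (f i) (f j) ei ej (i≢j ∘ f-injective)))

-- The 5-cycle

C5Adj? : ∀ i j → Dec (C5Adj i j)
C5Adj? i j = toℕ j ℕ.≟ (toℕ i + 1) ℕ.% 5 ⊎-dec toℕ i ℕ.≟ (toℕ j + 1) ℕ.% 5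

C₅ : Graph
C₅ = record
  { n      = 5
  ; Adj    = C5Adj
  ; symAdj = Sum.swap
  ; irrAdj = λ {i} → from-yes (all? λ i → ¬? (C5Adj? i i)) i
  }

-- i ↦ 2i (mod 5)
doubling : Fin 5 → Fin 5
doubling = Vec.lookup (# 0 ∷ # 2 ∷ # 4 ∷ # 1 ∷ # 3 ∷ [])

C₅-selfComplementary : IsHomomorphism C₅ (complement C₅) doubling
C₅-selfComplementary = from-yes (all? λ i → all? λ j →
  C5Adj? i j →-dec ¬? (doubling i ≟ᶠ doubling j) ×-dec ¬? (C5Adj? (doubling i) (doubling j)))

C₅-coloring-3-0 : Fin 5 → Fin 3 ⊎ Fin 0
C₅-coloring-3-0 = inj₁ ∘ Vec.lookup (# 0 ∷ # 1 ∷ # 0 ∷ # 1 ∷ # 2 ∷ [])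

C₅-coloring-0-3 : Fin 5 → Fin 0 ⊎ Fin 3
C₅-coloring-0-3 = inj₂ ∘ Vec.lookup (# 0 ∷ # 0 ∷ # 1 ∷ # 1 ∷ # 2 ∷ [])

C₅-coloring-1-2 : Fin 5 → Fin 1 ⊎ Fin 2
C₅-coloring-1-2 = Vec.lookup (inj₁ (# 0) ∷ inj₂ (# 1) ∷ inj₁ (# 0) ∷ inj₂ (# 0) ∷ inj₂ (# 0) ∷ [])

C₅-coloring-2-1 : Fin 5 → Fin 2 ⊎ Fin 1
C₅-coloring-2-1 = Vec.lookup (inj₁ (# 0) ∷ inj₁ (# 1) ∷ inj₁ (# 0) ∷ inj₁ (# 1) ∷ inj₂ (# 0) ∷ [])

C₅-coloring-3-0-valid : IsKLColoring C₅ 3 0 C₅-coloring-3-0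
C₅-coloring-3-0-valid = from-yes (isKLColoring? C₅ C5Adj? C₅-coloring-3-0)

C₅-coloring-0-3-valid : IsKLColoring C₅ 0 3 C₅-coloring-0-3
C₅-coloring-0-3-valid = from-yes (isKLColoring? C₅ C5Adj? C₅-coloring-0-3)

C₅-coloring-1-2-valid : IsKLColoring C₅ 1 2 C₅-coloring-1-2
C₅-coloring-1-2-valid = from-yes (isKLColoring? C₅ C5Adj? C₅-coloring-1-2)

C₅-coloring-2-1-valid : IsKLColoring C₅ 2 1 C₅-coloring-2-1
C₅-coloring-2-1-valid = from-yes (isKLColoring? C₅ C5Adj? C₅-coloring-2-1)

properColoring-C₅-threeColors : ∀ {k} (c : Fin 5 → Fin k) → IsProperColoring C₅ c →
  Σ (Vec (Fin 5) 3) λ ts → VecUnique.Unique (Vec.map c ts)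
properColoring-C₅-threeColors c proper with c (# 0) ≟ᶠ c (# 2)
... | no c₀≢c₂ =
  (# 0 ∷ # 1 ∷ # 2 ∷ []) ,
  (proper _ _ (inj₁ refl) ∷ c₀≢c₂ ∷ []) ∷ (proper _ _ (inj₁ refl) ∷ []) ∷ [] ∷ []
... | yes c₀≡c₂ =
  (# 0 ∷ # 3 ∷ # 4 ∷ []) ,
  (proper (# 2) (# 3) (inj₁ refl) ∘ trans (sym c₀≡c₂) ∷ proper _ _ (inj₂ refl) ∷ []) ∷ (proper _ _ (inj₁ refl) ∷ []) ∷ [] ∷ []

C₅-not-KLColorable-1-1 : ¬ KLColorable C₅ 1 1
C₅-not-KLColorable-1-1 (col , independent , clique) = impossible (col (# 0)) refl
  where
  adjacent-to-independent : ∀ {u v} → col u ≡ inj₁ zero → C5Adj u v → col v ≡ inj₂ zero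
  adjacent-to-independent {u} {v} cu uv with col v in cv
  ... | inj₁ zero = ⊥-elim (independent zero u v cu cv uv)
  ... | inj₂ zero = refl

  nonadjacent-to-clique : ∀ {u v} → col u ≡ inj₂ zero → u ≢ v → ¬ C5Adj u v → col v ≡ inj₁ zero
  nonadjacent-to-clique {u} {v} cu u≢v ¬uv with col v in cv
  ... | inj₁ zero = refl
  ... | inj₂ zero = ⊥-elim (¬uv (clique zero u v cu cv u≢v))

  1≁4 : ¬ C5Adj (# 1) (# 4)
  1≁4 (inj₁ ())
  1≁4 (inj₂ ())

  0≁2 : ¬ C5Adj (# 0) (# 2)
  0≁2 (inj₁ ())
  0≁2 (inj₂ ())

  0≁3 : ¬ C5Adj (# 0) (# 3)
  0≁3 (inj₁ ())
  0≁3 (inj₂ ())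

  -- If 0 is in the independent set, its non-adjacent neighbours 1 and 4 are in the clique;
  -- otherwise its non-neighbours 2 and 3, which are adjacent, are in the independent set.
  impossible : ∀ x → col (# 0) ≡ x → ⊥
  impossible (inj₁ zero) c₀ = 1≁4 (clique zero (# 1) (# 4)
    (adjacent-to-independent c₀ (inj₁ refl)) (adjacent-to-independent c₀ (inj₂ refl)) (λ ()))
  impossible (inj₂ zero) c₀ = independent zero (# 2) (# 3)
    (nonadjacent-to-clique c₀ (λ ()) 0≁2) (nonadjacent-to-clique c₀ (λ ()) 0≁3) (inj₁ refl)

inducedC₅⇒¬KLColorable-1-1 : ∀ G f → IsInducedEmbedding C₅ G f → ¬ KLColorable G 1 1
inducedC₅⇒¬KLColorable-1-1 G f embedding (col , coloring) =
  C₅-not-KLColorable-1-1 (col ∘ f , isKLColoring-restrict C₅ G embedding coloring)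

splitPartition⇒KLColorable-1-1 : ∀ G (tag : Vtx G → Part) →
  IsClique G (λ v → tag v ≡ cP) → IsIndependent G (λ v → tag v ≡ iP) → (∀ v → tag v ≢ sP) →
  KLColorable G 1 1
splitPartition⇒KLColorable-1-1 G tag C-clique I-independent no-S =
  side ∘ tag ,
  (λ a u v eu ev → I-independent u v (side-inj₁ (tag u) (no-S u) eu) (side-inj₁ (tag v) (no-S v) ev)) ,
  (λ b u v eu ev → C-clique u v (side-inj₂ (tag u) eu) (side-inj₂ (tag v) ev))
  where
  side : Part → Fin 1 ⊎ Fin 1
  side cP = inj₂ zero
  side _  = inj₁ zero
  side-inj₁ : ∀ t {a} → t ≢ sP → side t ≡ inj₁ a → t ≡ iP
  side-inj₁ sP t≢sP _ = ⊥-elim (t≢sP refl)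
  side-inj₁ iP _    _ = refl
  side-inj₂ : ∀ t {b} → side t ≡ inj₂ b → t ≡ cP
  side-inj₂ cP _ = refl

module Parts (G : Graph) (tag : Vtx G → Part) where

  members : Part → List (Vtx G)
  members p = filter (λ v → tag v ≟P p) (allV G)

  member : (p : Part) → Fin (partSize G tag p) → Vtx G
  member p = lookup (members p)

  member-tag : ∀ p r → tag (member p r) ≡ p
  member-tag p r = proj₂ (∈-filter⁻ (λ v → tag v ≟P p) {xs = allV G} (∈-lookup {xs = members p} r))

  member-injective : ∀ p → Injective _≡_ _≡_ (member p)
  member-injective p = unique-lookup-injective (ListUnique.filter⁺ (λ v → tag v ≟P p) (ListUnique.allFin⁺ (n G)))

  member-surjective : ∀ p v → tag v ≡ p → ∃ λ r → member p r ≡ v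
  member-surjective p v tv≡p = index v∈ , sym (lookup-index v∈)
    where
    v∈ : v ∈ members p
    v∈ = ∈-filter⁺ (λ v → tag v ≟P p) (∈-allFin v) tv≡p

-- Lower bounds

cliqueJoinedToC₅-lowerBound : ∀ G (tag : Vtx G → Part) p → IsClique G (λ v → tag v ≡ p) →
  ∀ f → IsHomomorphism C₅ G f → (∀ u i → tag u ≡ p → Adj G u (f i)) →
  ∀ {k} → ProperColorable G k → partSize G tag p + 3 ≤ k
cliqueJoinedToC₅-lowerBound G tag p clique f f-hom joined (c , proper) =
  ⊎-injection⇒+≤ [ c ∘ member p , c ∘ f ∘ Vec.lookup ts ]′ ([,]-injective on-clique on-cycle across)
  where
  open Parts G tag
  tricolored : Σ (Vec (Fin 5) 3) λ ts → VecUnique.Unique (Vec.map (c ∘ f) ts)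
  tricolored = properColoring-C₅-threeColors (c ∘ f) (λ i j → proper (f i) (f j) ∘ f-hom i j)

  ts : Vec (Fin 5) 3
  ts = proj₁ tricolored

  on-clique : Injective _≡_ _≡_ (c ∘ member p)
  on-clique {r} {r′} e with member p r ≟ᶠ member p r′
  ... | yes same = member-injective p same
  ... | no differ = ⊥-elim (proper _ _ (clique _ _ (member-tag p r) (member-tag p r′) differ) e)

  on-cycle : Injective _≡_ _≡_ (c ∘ f ∘ Vec.lookup ts)
  on-cycle {i} {j} e = VecUnique.lookup-injective (proj₂ tricolored) i j
    (trans (lookup-map i (c ∘ f) ts) (trans e (sym (lookup-map j (c ∘ f) ts))))

  across : ∀ r i → c (member p r) ≢ c (f (Vec.lookup ts i))
  across r i = proper _ _ (joined _ _ (member-tag p r))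

module PseudoSplit (G : Graph) (tag : Vtx G → Part)
  (C-clique : IsClique G (λ v → tag v ≡ cP))
  (I-independent : IsIndependent G (λ v → tag v ≡ iP))
  (C-complete-S : ∀ u v → tag u ≡ cP → tag v ≡ sP → Adj G u v)
  (I-anticomplete-S : ∀ u v → tag u ≡ iP → tag v ≡ sP → ¬ Adj G u v)
  (f : Fin 5 → Vtx G) (f-embedding : IsInducedEmbedding C₅ G f)
  (f-S : ∀ i → tag (f i) ≡ sP) (f-onto-S : ∀ v → tag v ≡ sP → ∃ λ i → f i ≡ v)
  where

  open Parts G tag

  private
    nC nI : ℕ
    nC = partSize G tag cP
    nI = partSize G tag iP

    f-adj : ∀ i j → (Adj G (f i) (f j) → C5Adj i j) × (C5Adj i j → Adj G (f i) (f j))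
    f-adj = proj₂ f-embedding

  χ-lowerBound : ∀ {k} → KLColorable G k 0 → nC + 3 ≤ k
  χ-lowerBound coloring =
    cliqueJoinedToC₅-lowerBound G tag cP C-clique f (λ i j → proj₂ (f-adj i j))
      (λ u i u∈C → C-complete-S u (f i) u∈C (f-S i)) (KLColorable⇒ProperColorable G coloring)

  -- In the complement, I is a clique joined to S, and S still induces a 5-cycle.
  θ-lowerBound : ∀ {ℓ} → KLColorable G 0 ℓ → nI + 3 ≤ ℓ
  θ-lowerBound coloring =
    cliqueJoinedToC₅-lowerBound (complement G) tag iP
      (λ u v u∈I v∈I u≢v → u≢v , I-independent u v u∈I v∈I)
      (f ∘ doubling)
      (λ i j → complement-homomorphism {C₅} {G} f-embedding (doubling i) (doubling j) ∘ C₅-selfComplementary i j)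
      (λ u i u∈I → (λ u≡v → iP≢sP (trans (sym u∈I) (trans (cong tag u≡v) (f-S (doubling i))))) ,
                   I-anticomplete-S u (f (doubling i)) u∈I (f-S (doubling i)))
      (KLColorable⇒ProperColorable-complement G coloring)
    where
    iP≢sP : iP ≢ sP
    iP≢sP ()

  data Position : Vtx G → Set where
    inC : ∀ r → Position (member cP r)
    inS : ∀ i → Position (f i)
    inI : ∀ r → Position (member iP r)

  position : ∀ v → Position v
  position v = locate (tag v) refl
    where
    locate : ∀ t → tag v ≡ t → Position v
    locate cP v∈C = let (r , r↦v) = member-surjective cP v v∈C in subst Position r↦v (inC r)
    locate sP v∈S = let (i , i↦v) = f-onto-S v v∈S in subst Position i↦v (inS i)
    locate iP v∈I = let (r , r↦v) = member-surjective iP v v∈I in subst Position r↦v (inI r)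

  record PartwiseColoring (k ℓ : ℕ) : Set where
    field
      onC : Fin nC → Fin k ⊎ Fin ℓ
      onS : Fin 5 → Fin k ⊎ Fin ℓ
      onI : Fin nI → Fin k ⊎ Fin ℓ
      onS-valid : IsKLColoring C₅ k ℓ onS
      onC-independent-singletons : ∀ {r r′ a} → onC r ≡ inj₁ a → onC r′ ≡ inj₁ a → r ≡ r′
      onI-clique-singletons : ∀ {r r′ b} → onI r ≡ inj₂ b → onI r′ ≡ inj₂ b → r ≡ r′
      C-S-independent-disjoint : ∀ {r i a} → onC r ≡ inj₁ a → onS i ≢ inj₁ a
      I-S-clique-disjoint : ∀ {r i b} → onI r ≡ inj₂ b → onS i ≢ inj₂ b
      C-I-disjoint : ∀ r r′ → onC r ≢ onI r′

  PartwiseColoring⇒KLColorable : ∀ {k ℓ} → PartwiseColoring k ℓ → KLColorable G k ℓ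
  PartwiseColoring⇒KLColorable {k} {ℓ} κ =
    colorAt ∘ position ,
    (λ a u v → independentAt (position u) (position v)) ,
    (λ b u v → cliqueAt (position u) (position v))
    where
    open PartwiseColoring κ

    colorAt : ∀ {v} → Position v → Fin k ⊎ Fin ℓ
    colorAt (inC r) = onC r
    colorAt (inS i) = onS i
    colorAt (inI r) = onI r

    adjacent⇒distinct : ∀ {u v} → Adj G u v → u ≢ v
    adjacent⇒distinct uv refl = irrAdj G uv

    independentAt : ∀ {u v a} (pu : Position u) (pv : Position v) →
      colorAt pu ≡ inj₁ a → colorAt pv ≡ inj₁ a → ¬ Adj G u v
    independentAt (inC r) (inC r′) eu ev = λ uv → adjacent⇒distinct uv (cong (member cP) (onC-independent-singletons eu ev))
    independentAt (inC r) (inS i)  eu ev = λ _ → C-S-independent-disjoint eu ev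
    independentAt (inC r) (inI r′) eu ev = λ _ → C-I-disjoint r r′ (trans eu (sym ev))
    independentAt (inS i) (inC r)  eu ev = λ _ → C-S-independent-disjoint ev eu
    independentAt (inS i) (inS j)  eu ev = proj₁ onS-valid _ i j eu ev ∘ proj₁ (f-adj i j)
    independentAt (inS i) (inI r)  eu ev = I-anticomplete-S _ _ (member-tag iP r) (f-S i) ∘ symAdj G
    independentAt (inI r) (inC r′) eu ev = λ _ → C-I-disjoint r′ r (trans ev (sym eu))
    independentAt (inI r) (inS i)  eu ev = I-anticomplete-S _ _ (member-tag iP r) (f-S i)
    independentAt (inI r) (inI r′) eu ev = I-independent _ _ (member-tag iP r) (member-tag iP r′)

    cliqueAt : ∀ {u v b} (pu : Position u) (pv : Position v) →
      colorAt pu ≡ inj₂ b → colorAt pv ≡ inj₂ b → u ≢ v → Adj G u v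
    cliqueAt (inC r) (inC r′) eu ev = C-clique _ _ (member-tag cP r) (member-tag cP r′)
    cliqueAt (inC r) (inS i)  eu ev = λ _ → C-complete-S _ _ (member-tag cP r) (f-S i)
    cliqueAt (inC r) (inI r′) eu ev = ⊥-elim (C-I-disjoint r r′ (trans eu (sym ev)))
    cliqueAt (inS i) (inC r)  eu ev = λ _ → symAdj G (C-complete-S _ _ (member-tag cP r) (f-S i))
    cliqueAt (inS i) (inS j)  eu ev = λ fi≢fj → proj₂ (f-adj i j) (proj₂ onS-valid _ i j eu ev (fi≢fj ∘ cong f))
    cliqueAt (inS i) (inI r)  eu ev = ⊥-elim (I-S-clique-disjoint ev eu)
    cliqueAt (inI r) (inC r′) eu ev = ⊥-elim (C-I-disjoint r′ r (trans ev (sym eu)))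
    cliqueAt (inI r) (inS i)  eu ev = ⊥-elim (I-S-clique-disjoint eu ev)
    cliqueAt (inI r) (inI r′) eu ev = λ u≢v → ⊥-elim (u≢v (cong (member iP) (onI-clique-singletons eu ev)))

  χ-colorable : KLColorable G (nC + 3) 0
  χ-colorable = PartwiseColoring⇒KLColorable record
    { onC = λ r → inj₁ (r ↑ˡ 3)
    ; onS = Sum.map (nC ↑ʳ_) id ∘ C₅-coloring-3-0
    ; onI = const (inj₁ (nC ↑ʳ zero))
    ; onS-valid = isKLColoring-map C₅ (↑ʳ-injective nC _ _) id C₅-coloring-3-0-valid
    ; onC-independent-singletons = λ eu ev → ↑ˡ-injective 3 _ _ (inj₁-injective (trans eu (sym ev)))
    ; onI-clique-singletons = λ ()
    ; C-S-independent-disjoint = λ { refl es → ↑ˡ≢↑ʳ _ _ (sym (inj₁-injective es)) }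
    ; I-S-clique-disjoint = λ ()
    ; C-I-disjoint = λ r _ e → ↑ˡ≢↑ʳ r zero (inj₁-injective e)
    }

  θ-colorable : KLColorable G 0 (nI + 3)
  θ-colorable = PartwiseColoring⇒KLColorable record
    { onC = const (inj₂ (nI ↑ʳ zero))
    ; onS = Sum.map id (nI ↑ʳ_) ∘ C₅-coloring-0-3
    ; onI = λ r → inj₂ (r ↑ˡ 3)
    ; onS-valid = isKLColoring-map C₅ id (↑ʳ-injective nI _ _) C₅-coloring-0-3-valid
    ; onC-independent-singletons = λ ()
    ; onI-clique-singletons = λ eu ev → ↑ˡ-injective 3 _ _ (inj₂-injective (trans eu (sym ev)))
    ; C-S-independent-disjoint = λ ()
    ; I-S-clique-disjoint = λ { refl es → ↑ˡ≢↑ʳ _ _ (sym (inj₂-injective es)) }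
    ; C-I-disjoint = λ _ r′ e → ↑ˡ≢↑ʳ r′ zero (sym (inj₂-injective e))
    }

  C₅-coloring⇒KLColorable : ∀ {k ℓ} (σ : Fin 5 → Fin (suc k) ⊎ Fin (suc ℓ)) →
    IsKLColoring C₅ (suc k) (suc ℓ) σ → KLColorable G (suc k) (suc ℓ)
  C₅-coloring⇒KLColorable σ σ-valid = PartwiseColoring⇒KLColorable record
    { onC = const (inj₂ zero)
    ; onS = σ
    ; onI = const (inj₁ zero)
    ; onS-valid = σ-valid
    ; onC-independent-singletons = λ ()
    ; onI-clique-singletons = λ ()
    ; C-S-independent-disjoint = λ ()
    ; I-S-clique-disjoint = λ ()
    ; C-I-disjoint = λ _ _ ()
    }

  KLColorable-mixed : ∀ k ℓ → 1 ≤ k → 1 ≤ ℓ → 3 ≤ k + ℓ → KLColorable G k ℓ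
  KLColorable-mixed 1 ℓ _ _ (s≤s 2≤ℓ) =
    KLColorable-mono G ≤-refl 2≤ℓ (C₅-coloring⇒KLColorable C₅-coloring-1-2 C₅-coloring-1-2-valid)
  KLColorable-mixed (suc (suc k)) ℓ _ 1≤ℓ _ =
    KLColorable-mono G (s≤s (s≤s ℕ.z≤n)) 1≤ℓ (C₅-coloring⇒KLColorable C₅-coloring-2-1 C₅-coloring-2-1-valid)

mainTheorem9 : (G : Graph) → IsImperfectPseudoSplit G →
    (tag : Vtx G → Part) → IsPseudoSplitPartition G tag →
    ((k : ℕ) → KLColorable G k 0 ⇔ (partSize G tag cP + 3 ≤ k)) ×
    ((ℓ : ℕ) → KLColorable G 0 ℓ ⇔ (partSize G tag iP + 3 ≤ ℓ)) ×
    (¬ KLColorable G 1 1) ×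
    ((k ℓ : ℕ) → 1 ≤ k → 1 ≤ ℓ → 3 ≤ k + ℓ → KLColorable G k ℓ) ×
    IsChromaticNumber G (partSize G tag cP + 3) ×
    IsCliqueCoverNumber G (partSize G tag iP + 3)
mainTheorem9 G (_ , _ , g , g-injective , _ , _ , g-adj) tag (C-clique , I-independent , S-shape , C-S , I-S)
  with S-shape
... | inj₁ S-empty = ⊥-elim (inducedC₅⇒¬KLColorable-1-1 G g (g-injective , g-adj)
        (splitPartition⇒KLColorable-1-1 G tag C-clique I-independent S-empty))
... | inj₂ (f , f-injective , f-S , f-onto-S , f-adj) =
  (λ k → mk⇔ χ-lowerBound (λ nC+3≤k → KLColorable-mono G nC+3≤k ≤-refl χ-colorable)) ,
  (λ ℓ → mk⇔ θ-lowerBound (λ nI+3≤ℓ → KLColorable-mono G ≤-refl nI+3≤ℓ θ-colorable)) ,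
  inducedC₅⇒¬KLColorable-1-1 G f (f-injective , f-adj) ,
  KLColorable-mixed ,
  (χ-colorable , λ _ → χ-lowerBound) ,
  (θ-colorable , λ _ → θ-lowerBound)
  where open PseudoSplit G tag C-clique I-independent C-S I-S f (f-injective , f-adj) f-S f-onto-S
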